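{- Let $M$ be a matroid on $E$ and $F_1,\dots,F_m\subseteq E$. Then $\bigcap_{i=1}^m M(F_i)\subseteq\mathcal{B}\big(\bigodot_{i=1}^m M(F_i)\big)$, i.e. every set which is a base of each $M(F_i)$ is a base of $\bigodot_{i=1}^m M(F_i)$.
   Context: For $F\subseteq E$, $M(F):=(M/F)\oplus(M|_F)$, a matroid on $E$. $\bigcap_i M(F_i)$ is the collection of sets that are bases of every $M(F_i)$; $\mathcal{B}(N)$ is the collection of bases of $N$. For $\sigma\subseteq[m]$, $F^+_\sigma=\bigcup_{i\in\sigma}F_i$, $F^-_\sigma=\bigcap_{j\notin\sigma}F_j$ ($F^-_{[m]}=E$), and $\bigodot_{i=1}^m M(F_i):=\bigoplus_{\sigma\subseteq[m]}(M/F^+_\sigma)|_{F^-_\sigma\setminus F^+_\sigma}$, a matroid on $E$. -}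

module Defs where

open import Data.Nat using (ℕ; zero; suc; _<_)
open import Data.Bool using (Bool; true; false; if_then_else_)
open import Data.Fin using (Fin) renaming (zero to fzero; suc to fsuc)
open import Data.Fin.Subset using (Subset; _∈_; _∉_; _⊆_; _∪_; _∩_; _─_; ⊤; ⊥; ⁅_⁆; ∣_∣; ⋃)
open import Data.Vec using ([]; _∷_)
open import Data.List using (List; map; _++_) renaming ([] to []ˡ; _∷_ to _∷ˡ_)
open import Data.Product using (Σ; ∃; _×_; _,_)
open import Level using (Level; suc; _⊔_) renaming (zero to 0ℓ)

-- Minors and direct sums of a
-- matroid on E are all set systems on subsets of E, so no re-indexing
-- of ground sets is needed.

record SetSystem (n : ℕ) : Set₁ where
  field
    ground : Subset n
    Indep  : Subset n → Set

open SetSystem public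

IsBase : ∀ {n} → SetSystem n → Subset n → Set
IsBase N B = Indep N B × (∀ I → Indep N I → B ⊆ I → I ⊆ B)

record Matroid (n : ℕ) : Set₁ where
  field
    Ind       : Subset n → Set
    ind-empty : Ind ⊥
    ind-down  : ∀ {I J} → Ind J → I ⊆ J → Ind I
    ind-aug   : ∀ {I J} → Ind I → Ind J → ∣ I ∣ < ∣ J ∣ →
                ∃ λ x → x ∈ J × x ∉ I × Ind (I ∪ ⁅ x ⁆)

open Matroid public

sys : ∀ {n} → Matroid n → SetSystem n
sys M = record { ground = ⊤ ; Indep = Ind M }

_∣ʳ_ : ∀ {n} → SetSystem n → Subset n → SetSystem n
N ∣ʳ F = record
  { ground = ground N ∩ F
  ; Indep  = λ I → I ⊆ ground N ∩ F × Indep N I }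

_/ᶜ_ : ∀ {n} → SetSystem n → Subset n → SetSystem n
N /ᶜ F = record
  { ground = ground N ─ F
  ; Indep  = λ I → I ⊆ ground N ─ F ×
                   (∃ λ J → IsBase (N ∣ʳ F) J × Indep N (I ∪ J)) }

-- Direct sum of two set systems (used on disjoint ground sets).
_⊕_ : ∀ {n} → SetSystem n → SetSystem n → SetSystem n
N₁ ⊕ N₂ = record
  { ground = ground N₁ ∪ ground N₂
  ; Indep  = λ I → I ⊆ ground N₁ ∪ ground N₂ ×
                   Indep N₁ (I ∩ ground N₁) × Indep N₂ (I ∩ ground N₂) }

allSubsets : ∀ m → List (Subset m)
allSubsets zero    = [] ∷ˡ []ˡ
allSubsets (suc m) = map (true ∷_) (allSubsets m) ++ map (false ∷_) (allSubsets m)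

⨁ : ∀ {n m} → (Subset m → SetSystem n) → SetSystem n
⨁ {n} {m} N = record
  { ground = ⋃ (map (λ σ → ground (N σ)) (allSubsets m))
  ; Indep  = λ I → I ⊆ ⋃ (map (λ σ → ground (N σ)) (allSubsets m)) ×
                   (∀ σ → Indep (N σ) (I ∩ ground (N σ))) }

M⟨_⟩ : ∀ {n} → Matroid n → Subset n → SetSystem n
M⟨ M ⟩ F = (sys M /ᶜ F) ⊕ (sys M ∣ʳ F)

-- F⁺_σ = ⋃_{i∈σ} F_i
F⁺ : ∀ {n m} → (Fin m → Subset n) → Subset m → Subset n
F⁺ {m = zero}  F []      = ⊥
F⁺ {m = suc m} F (b ∷ σ) = (if b then F fzero else ⊥) ∪ F⁺ (λ i → F (fsuc i)) σ

-- F⁻_σ = ⋂_{j∉σ} F_j   (so F⁻_[m] = E)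
F⁻ : ∀ {n m} → (Fin m → Subset n) → Subset m → Subset n
F⁻ {m = zero}  F []      = ⊤
F⁻ {m = suc m} F (b ∷ σ) = (if b then ⊤ else F fzero) ∩ F⁻ (λ i → F (fsuc i)) σ

⨀ : ∀ {n m} → Matroid n → (Fin m → Subset n) → SetSystem n
⨀ M F = ⨁ (λ σ → (sys M /ᶜ F⁺ F σ) ∣ʳ (F⁻ F σ ─ F⁺ F σ))

module Submission where

-- Say "B spans P"
-- when (B ∩ P) + z is dependent in M for every z ∈ P ∖ B.
--  * From one base B of M(F): B spans F, B is independent in M, and B
--    spans E (B is a base of M).  Independence needs that a basis of M|F
--    may be swapped for any other independent spanning subset of F inside
--    an independent set; this is proved by augmentation and counting.
--  * Spanning is closed under unions, and, for a base B of M, also under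
--    intersections: (B ∩ P) + y is dependent iff P contains the
--    fundamental circuit of y with respect to B.  Hence B spans every
--    F⁺_σ = ⋃_{i∈σ} F_i and every F⁻_σ = ⋂_{j∉σ} F_j.
--  * The σ-summand of ⨀ is (M/P)|_{Q∖P} with P = F⁺_σ, Q = F⁻_σ.  If B is
--    independent and spans P and Q, then B meets this summand in an
--    independent set that no independent set of the summand can exceed.
--  * Every x ∈ E lies in the summand of σ = {i : x ∉ F_i}, so these
--    summands cover E; the theorem follows summand by summand.

open import Defs
open import Data.Nat using (ℕ; zero; suc; _+_; _≤_; _<_; z≤n; s≤s; _≤?_)
open import Data.Nat.Properties
  using (≤-trans; n≤1+n; ≤-reflexive; +-identityʳ; +-suc; m≤n+m; +-monoˡ-≤; +-monoʳ-≤; +-monoˡ-<;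
         ≤⇒≯; ≰⇒>; module ≤-Reasoning)
open import Data.Bool using (true; false)
open import Data.Fin using (Fin; _≟_) renaming (zero to fzero; suc to fsuc)
open import Data.Fin.Properties using (any?)
open import Data.Fin.Subset using (Subset; _∈_; _∉_; _⊆_; _∪_; _∩_; _─_; _-_; ⊤; ⊥; ⁅_⁆; ∣_∣; ⋃)
open import Data.Fin.Subset.Properties
  using (_∈?_; ∈⊤; ∉⊥; ⊆-trans; x∈⁅x⁆; x∈⁅y⁆⇒x≡y; x∈p∩q⁺; x∈p∩q⁻; p∩q⊆p; p∩q⊆q; x∈p∪q⁺; x∈p∪q⁻;
         x∈p∧x∉q⇒x∈p─q; p─q⊆p; x∈p∧x≢y⇒x∈p-y; x∈p⇒∣p-x∣<∣p∣; p⊂q⇒∣p∣<∣q∣)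
open import Data.Vec using ([]; _∷_; here; there)
open import Data.List using (List; map) renaming (_∷_ to _∷ˡ_)
open import Data.List.Membership.Propositional using () renaming (_∈_ to _∈ˡ_)
open import Data.List.Membership.Propositional.Properties using (∈-map⁺; ∈-++⁺ˡ; ∈-++⁺ʳ)
open import Data.List.Relation.Unary.Any using () renaming (here to hereˡ; there to thereˡ)
open import Data.Product using (∃; _×_; _,_; proj₁; proj₂)
open import Data.Sum using (_⊎_; inj₁; inj₂; [_,_])
open import Data.Empty using (⊥-elim)
open import Relation.Nullary using (¬_; yes; no; ¬?; _×-dec_)
open import Relation.Nullary.Decidable using (decidable-stable)
open import Relation.Binary.PropositionalEquality using (_≡_; refl; sym; subst)

∈-─⁻ : ∀ {n} {x : Fin n} (p q : Subset n) → x ∈ p ─ q → x ∈ p × x ∉ q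
∈-─⁻ (true ∷ p) (false ∷ q) here      = here , λ ()
∈-─⁻ (_ ∷ p)    (true ∷ q)  (there h) = let a , b = ∈-─⁻ p q h in there a , λ { (there z) → b z }
∈-─⁻ (_ ∷ p)    (false ∷ q) (there h) = let a , b = ∈-─⁻ p q h in there a , λ { (there z) → b z }

∣p∪q∣≤∣p∣+∣q∣ : ∀ {n} (p q : Subset n) → ∣ p ∪ q ∣ ≤ ∣ p ∣ + ∣ q ∣
∣p∪q∣≤∣p∣+∣q∣ []          []          = z≤n
∣p∪q∣≤∣p∣+∣q∣ (true ∷ p)  (true ∷ q)  = s≤s (≤-trans (∣p∪q∣≤∣p∣+∣q∣ p q) (+-monoʳ-≤ ∣ p ∣ (n≤1+n _)))
∣p∪q∣≤∣p∣+∣q∣ (true ∷ p)  (false ∷ q) = s≤s (∣p∪q∣≤∣p∣+∣q∣ p q)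
∣p∪q∣≤∣p∣+∣q∣ (false ∷ p) (true ∷ q)  rewrite +-suc ∣ p ∣ ∣ q ∣ = s≤s (∣p∪q∣≤∣p∣+∣q∣ p q)
∣p∪q∣≤∣p∣+∣q∣ (false ∷ p) (false ∷ q) = ∣p∪q∣≤∣p∣+∣q∣ p q

disjoint⇒∣p∣+∣q∣≤∣p∪q∣ : ∀ {n} (p q : Subset n) → (∀ {x} → x ∈ p → x ∉ q) → ∣ p ∣ + ∣ q ∣ ≤ ∣ p ∪ q ∣
disjoint⇒∣p∣+∣q∣≤∣p∪q∣ []          []          _ = z≤n
disjoint⇒∣p∣+∣q∣≤∣p∪q∣ (true ∷ p)  (true ∷ q)  d = ⊥-elim (d here here)
disjoint⇒∣p∣+∣q∣≤∣p∪q∣ (true ∷ p)  (false ∷ q) d = s≤s (disjoint⇒∣p∣+∣q∣≤∣p∪q∣ p q (λ a b → d (there a) (there b)))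
disjoint⇒∣p∣+∣q∣≤∣p∪q∣ (false ∷ p) (true ∷ q)  d rewrite +-suc ∣ p ∣ ∣ q ∣ =
  s≤s (disjoint⇒∣p∣+∣q∣≤∣p∪q∣ p q (λ a b → d (there a) (there b)))
disjoint⇒∣p∣+∣q∣≤∣p∪q∣ (false ∷ p) (false ∷ q) d = disjoint⇒∣p∣+∣q∣≤∣p∪q∣ p q (λ a b → d (there a) (there b))

module _ {n : ℕ} where

  infixr 4 _&_
  _&_ : ∀ {x : Fin n} {p q} → x ∈ p → x ∈ q → x ∈ p ∩ q
  a & b = x∈p∩q⁺ (a , b)

  ∈-∩⁻ : ∀ {x : Fin n} {p q} → x ∈ p ∩ q → x ∈ p × x ∈ q
  ∈-∩⁻ {p = p} {q} = x∈p∩q⁻ p q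

  ∪-inˡ : ∀ {x : Fin n} {p q} → x ∈ p → x ∈ p ∪ q
  ∪-inˡ h = x∈p∪q⁺ (inj₁ h)

  ∪-inʳ : ∀ {x : Fin n} {p q} → x ∈ q → x ∈ p ∪ q
  ∪-inʳ h = x∈p∪q⁺ (inj₂ h)

  ∪-lub : ∀ {p q r : Subset n} → p ⊆ r → q ⊆ r → p ∪ q ⊆ r
  ∪-lub {p} {q} p⊆r q⊆r h = [ p⊆r , q⊆r ] (x∈p∪q⁻ p q h)

  ∩-monoʳ : ∀ {p q r : Subset n} → q ⊆ r → p ∩ q ⊆ p ∩ r
  ∩-monoʳ q⊆r h = let a , b = ∈-∩⁻ h in a & q⊆r b

  ∩-monoˡ : ∀ {p q r : Subset n} → p ⊆ q → p ∩ r ⊆ q ∩ r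
  ∩-monoˡ p⊆q h = let a , b = ∈-∩⁻ h in p⊆q a & b

  -- P as a subset of the ground set ⊤ ∩ P of M|P.
  ⊆⊤∩ : ∀ {p : Subset n} → p ⊆ ⊤ ∩ p
  ⊆⊤∩ h = ∈⊤ & h

  new : ∀ {y : Fin n} {p} → y ∈ p ∪ ⁅ y ⁆
  new {y} = ∪-inʳ (x∈⁅x⁆ y)

  ∈-∪⁅⁆⁻ : ∀ {x y : Fin n} {p} → x ∈ p ∪ ⁅ y ⁆ → x ∈ p ⊎ x ≡ y
  ∈-∪⁅⁆⁻ {y = y} {p} h with x∈p∪q⁻ p ⁅ y ⁆ h
  ... | inj₁ xp = inj₁ xp
  ... | inj₂ xy = inj₂ (x∈⁅y⁆⇒x≡y y xy)

  ⊆-∪⁅⁆ : ∀ {y : Fin n} {p q} → p ⊆ q → y ∈ q → p ∪ ⁅ y ⁆ ⊆ q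
  ⊆-∪⁅⁆ {y} {q = q} p⊆q yq = ∪-lub p⊆q (λ h → subst (_∈ q) (sym (x∈⁅y⁆⇒x≡y y h)) yq)

  ∪⁅⁆-mono : ∀ {y : Fin n} {p q} → p ⊆ q → p ∪ ⁅ y ⁆ ⊆ q ∪ ⁅ y ⁆
  ∪⁅⁆-mono p⊆q = ⊆-∪⁅⁆ (λ h → ∪-inˡ (p⊆q h)) new

  ∪⁅⁆-∩-outside : ∀ {y : Fin n} {p r} → y ∉ r → (p ∪ ⁅ y ⁆) ∩ r ⊆ p ∩ r
  ∪⁅⁆-∩-outside {p = p} y∉r h with ∈-∩⁻ h
  ... | h₁ , h₂ with ∈-∪⁅⁆⁻ {p = p} h₁
  ...   | inj₁ xp   = xp & h₂
  ...   | inj₂ refl = ⊥-elim (y∉r h₂)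

  ∪⁅⁆-∩ : ∀ {y : Fin n} {p r} → (p ∪ ⁅ y ⁆) ∩ r ⊆ (p ∩ r) ∪ ⁅ y ⁆
  ∪⁅⁆-∩ {p = p} h with ∈-∩⁻ h
  ... | h₁ , h₂ with ∈-∪⁅⁆⁻ {p = p} h₁
  ...   | inj₁ xp   = ∪-inˡ (xp & h₂)
  ...   | inj₂ refl = new

  ⊆-or-witness : ∀ (p q : Subset n) → p ⊆ q ⊎ ∃ λ x → x ∈ p × x ∉ q
  ⊆-or-witness p q with any? (λ x → (x ∈? p) ×-dec ¬? (x ∈? q))
  ... | yes w  = inj₂ w
  ... | no ¬w = inj₁ λ {x} xp → decidable-stable (x ∈? q) (λ x∉q → ¬w (x , xp , x∉q))

  ⊂⇒∣<∣ : ∀ {x : Fin n} {p q} → p ⊆ q → x ∈ q → x ∉ p → ∣ p ∣ < ∣ q ∣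
  ⊂⇒∣<∣ p⊆q xq x∉p = p⊂q⇒∣p∣<∣q∣ (p⊆q , _ , xq , x∉p)

  ⊆∧∣≥∣⇒⊇ : ∀ {p q : Subset n} → p ⊆ q → ∣ q ∣ ≤ ∣ p ∣ → q ⊆ p
  ⊆∧∣≥∣⇒⊇ {p} p⊆q q≤p {x} xq =
    decidable-stable (x ∈? p) (λ x∉p → ≤⇒≯ q≤p (⊂⇒∣<∣ p⊆q xq x∉p))

Spans : ∀ {n} → Matroid n → Subset n → Subset n → Set
Spans M B P = ∀ {z} → z ∈ P → z ∉ B → ¬ Ind M ((B ∩ P) ∪ ⁅ z ⁆)

module _ {n} (M : Matroid n) where

  augment : ∀ {Y K} → Ind M Y → Ind M K →
            ∃ λ Z → Y ⊆ Z × Z ⊆ Y ∪ K × ∣ K ∣ ≤ ∣ Z ∣ × Ind M Z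
  augment {Y} {K} iY iK = go ∣ K ∣ iY (m≤n+m ∣ K ∣ ∣ Y ∣)
    where
    -- k bounds the number of elements still to be added.
    go : ∀ k {Y} → Ind M Y → ∣ K ∣ ≤ ∣ Y ∣ + k →
         ∃ λ Z → Y ⊆ Z × Z ⊆ Y ∪ K × ∣ K ∣ ≤ ∣ Z ∣ × Ind M Z
    go zero {Y} iY K≤Y+0 = Y , (λ h → h) , ∪-inˡ , ≤-trans K≤Y+0 (≤-reflexive (+-identityʳ ∣ Y ∣)) , iY
    go (suc k) {Y} iY K≤Y+k with ∣ K ∣ ≤? ∣ Y ∣
    ... | yes K≤Y = Y , (λ h → h) , ∪-inˡ , K≤Y , iY
    ... | no K≰Y with ind-aug M iY iK (≰⇒> K≰Y)
    ...   | x , xK , x∉Y , iYx with go k iYx bound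
      where
      bound : ∣ K ∣ ≤ ∣ Y ∪ ⁅ x ⁆ ∣ + k
      bound = ≤-trans K≤Y+k (≤-trans (≤-reflexive (+-suc ∣ Y ∣ k))
                (+-monoˡ-≤ k (⊂⇒∣<∣ ∪-inˡ (new {p = Y}) x∉Y)))
    ...     | Z , Yx⊆Z , Z⊆Yx∪K , K≤Z , iZ =
      Z , (λ h → Yx⊆Z (∪-inˡ h)) , (λ h → ∪-lub (⊆-∪⁅⁆ ∪-inˡ (∪-inʳ xK)) ∪-inʳ (Z⊆Yx∪K h)) , K≤Z , iZ

  restriction-base-card : ∀ {P J A} → A ⊆ P → Ind M A → IsBase (sys M ∣ʳ P) J → ∣ A ∣ ≤ ∣ J ∣
  restriction-base-card {P} {J} {A} A⊆P iA ((J⊆P , iJ) , J-max) with ∣ A ∣ ≤? ∣ J ∣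
  ... | yes A≤J = A≤J
  ... | no A≰J with ind-aug M iJ iA (≰⇒> A≰J)
  ...   | x , xA , x∉J , iJx =
    ⊥-elim (x∉J (J-max (J ∪ ⁅ x ⁆) (⊆-∪⁅⁆ J⊆P (∈⊤ & A⊆P xA) , iJx) ∪-inˡ new))

  restriction-base : ∀ {B P} → Ind M (B ∩ P) → Spans M B P → IsBase (sys M ∣ʳ P) (B ∩ (⊤ ∩ P))
  restriction-base {B} {P} iBP B-spans =
    (p∩q⊆q B _ , ind-down M iBP (∩-monoʳ (p∩q⊆q ⊤ P))) , maximal
    where
    maximal : ∀ I → I ⊆ ⊤ ∩ P × Ind M I → B ∩ (⊤ ∩ P) ⊆ I → I ⊆ B ∩ (⊤ ∩ P)
    maximal I (I⊆P , iI) B⊆I {z} zI with z ∈? B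
    ... | yes zB = zB & I⊆P zI
    ... | no z∉B = ⊥-elim (B-spans (p∩q⊆q ⊤ P (I⊆P zI)) z∉B (ind-down M iI
                     (⊆-∪⁅⁆ (λ h → B⊆I (∩-monoʳ ⊆⊤∩ h)) zI)))

  -- In a contraction, any basis J of M|P may be replaced by an independent
  -- spanning set B ∩ P of P: contraction does not depend on the basis.
  swap-restriction-base : ∀ {P I J B} → I ⊆ ⊤ ─ P → IsBase (sys M ∣ʳ P) J → Ind M (I ∪ J) →
                          Ind M (B ∩ P) → Spans M B P → Ind M (I ∪ (B ∩ P))
  swap-restriction-base {P} {I} {J} {B} I⊆E∖P bJ@((J⊆P , _) , _) iIJ iBP B-spans
    with augment iBP iIJ
  ... | Z , BP⊆Z , Z⊆ , IJ≤Z , iZ = ind-down M iZ (⊆∧∣≥∣⇒⊇ Z⊆I∪BP card)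
    where
    Z⊆I∪BP : Z ⊆ I ∪ (B ∩ P)
    Z⊆I∪BP {z} zZ with x∈p∪q⁻ (B ∩ P) (I ∪ J) (Z⊆ zZ)
    ... | inj₁ zBP = ∪-inʳ zBP
    ... | inj₂ zIJ with x∈p∪q⁻ I J zIJ
    ...   | inj₁ zI = ∪-inˡ zI
    ...   | inj₂ zJ with z ∈? B
    ...     | yes zB = ∪-inʳ (zB & p∩q⊆q ⊤ P (J⊆P zJ))
    ...     | no z∉B = ⊥-elim (B-spans (p∩q⊆q ⊤ P (J⊆P zJ)) z∉B (ind-down M iZ (⊆-∪⁅⁆ BP⊆Z zZ)))
    card : ∣ I ∪ (B ∩ P) ∣ ≤ ∣ Z ∣
    card = begin
      ∣ I ∪ (B ∩ P) ∣     ≤⟨ ∣p∪q∣≤∣p∣+∣q∣ I (B ∩ P) ⟩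
      ∣ I ∣ + ∣ B ∩ P ∣   ≤⟨ +-monoʳ-≤ ∣ I ∣ (restriction-base-card (p∩q⊆q B P) iBP bJ) ⟩
      ∣ I ∣ + ∣ J ∣       ≤⟨ disjoint⇒∣p∣+∣q∣≤∣p∪q∣ I J
                               (λ zI zJ → proj₂ (∈-─⁻ ⊤ P (I⊆E∖P zI)) (p∩q⊆q ⊤ P (J⊆P zJ))) ⟩
      ∣ I ∪ J ∣           ≤⟨ IJ≤Z ⟩
      ∣ Z ∣               ∎
      where open ≤-Reasoning

  spans-⊥ : ∀ {B} → Spans M B ⊥
  spans-⊥ z∈⊥ = ⊥-elim (∉⊥ z∈⊥)

  spans-∪ : ∀ {B P Q} → Spans M B P → Spans M B Q → Spans M B (P ∪ Q)
  spans-∪ {B} {P} {Q} B-spans-P B-spans-Q {z} zPQ z∉B iz with x∈p∪q⁻ P Q zPQ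
  ... | inj₁ zP = B-spans-P zP z∉B (ind-down M iz (∪⁅⁆-mono (∩-monoʳ ∪-inˡ)))
  ... | inj₂ zQ = B-spans-Q zQ z∉B (ind-down M iz (∪⁅⁆-mono (∩-monoʳ ∪-inʳ)))

  -- The fundamental circuit of y ∉ B with respect to an independent B with
  -- B + y dependent consists of y and the x ∈ B that can be exchanged for y.
  module FundamentalCircuit {B : Subset n} {y : Fin n}
           (iB : Ind M B) (y∉B : y ∉ B) (B+y-dep : ¬ Ind M (B ∪ ⁅ y ⁆)) where

    InCircuit : Fin n → Set
    InCircuit x = x ∈ B × Ind M ((B - x) ∪ ⁅ y ⁆)

    circuit⊆⇒dependent : ∀ {Y} → Y ⊆ B → (∀ {x} → InCircuit x → x ∈ Y) → ¬ Ind M (Y ∪ ⁅ y ⁆)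
    circuit⊆⇒dependent {Y} Y⊆B circuit⊆Y iYy with augment iYy iB
    ... | Z , Yy⊆Z , Z⊆Yy∪B , B≤Z , iZ with ⊆-or-witness B Z
    ...   | inj₁ B⊆Z = B+y-dep (ind-down M iZ (⊆-∪⁅⁆ B⊆Z (Yy⊆Z new)))
    ...   | inj₂ (x , xB , x∉Z)
            with ind-aug M (ind-down M iB (p─q⊆p B ⁅ x ⁆)) iZ (≤-trans (x∈p⇒∣p-x∣<∣p∣ xB) B≤Z)
    ...     | z , zZ , z∉B-x , iB-x+z = x∉Z (Yy⊆Z (∪-inˡ (circuit⊆Y (xB , exchange))))
      where
      -- the element entering B - x must be y itself
      z∉B : z ∉ B
      z∉B zB with z ≟ x
      ... | yes refl = x∉Z zZ
      ... | no z≢x = z∉B-x (x∈p∧x≢y⇒x∈p-y zB z≢x)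
      z≡y : z ≡ y
      z≡y with x∈p∪q⁻ (Y ∪ ⁅ y ⁆) B (Z⊆Yy∪B zZ)
      ... | inj₂ zB = ⊥-elim (z∉B zB)
      ... | inj₁ zYy with ∈-∪⁅⁆⁻ {p = Y} zYy
      ...   | inj₁ zY  = ⊥-elim (z∉B (Y⊆B zY))
      ...   | inj₂ z≡y = z≡y
      exchange : Ind M ((B - x) ∪ ⁅ y ⁆)
      exchange = subst (λ w → Ind M ((B - x) ∪ ⁅ w ⁆)) z≡y iB-x+z

    dependent⇒circuit⊆ : ∀ {X x} → ¬ Ind M ((B ∩ X) ∪ ⁅ y ⁆) → InCircuit x → x ∈ X
    dependent⇒circuit⊆ {X} {x} BX+y-dep (xB , iB-x+y) =
      decidable-stable (x ∈? X) λ x∉X → BX+y-dep (ind-down M iB-x+y (∪⁅⁆-mono (λ h →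
        let zB , zX = ∈-∩⁻ h in x∈p∧x≢y⇒x∈p-y zB (λ { refl → x∉X zX }))))

  spans-∩ : ∀ {B P Q} → Ind M B → Spans M B ⊤ → Spans M B P → Spans M B Q → Spans M B (P ∩ Q)
  spans-∩ {B} {P} {Q} iB B-spans-E B-spans-P B-spans-Q {z} zPQ z∉B =
    circuit⊆⇒dependent (p∩q⊆p B (P ∩ Q)) λ c →
      proj₁ c & dependent⇒circuit⊆ (B-spans-P zP z∉B) c & dependent⇒circuit⊆ (B-spans-Q zQ z∉B) c
    where
    zP : z ∈ P
    zP = proj₁ (∈-∩⁻ zPQ)
    zQ : z ∈ Q
    zQ = proj₂ (∈-∩⁻ zPQ)
    open FundamentalCircuit iB z∉B
           (λ iBz → B-spans-E ∈⊤ z∉B (ind-down M iBz (∪⁅⁆-mono (p∩q⊆p B ⊤))))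

base-no-extension : ∀ {n} {N : SetSystem n} {B x} → IsBase N B → Indep N (B ∪ ⁅ x ⁆) → x ∈ B
base-no-extension (_ , B-max) iBx = B-max _ iBx ∪-inˡ new

module _ {n} (M : Matroid n) where

  M⟨⟩-indep : ∀ {F I J} → IsBase (sys M ∣ʳ F) J → Ind M ((I ∩ (⊤ ─ F)) ∪ J) →
              Ind M (I ∩ (⊤ ∩ F)) → Indep (M⟨ M ⟩ F) I
  M⟨⟩-indep {F} {I} {J} bJ iI/F iI∣F =
    (λ {x} _ → cover x) , (p∩q⊆q I (⊤ ─ F) , J , bJ , iI/F) , (p∩q⊆q I (⊤ ∩ F) , iI∣F)
    where
    cover : ∀ x → x ∈ (⊤ ─ F) ∪ (⊤ ∩ F)
    cover x with x ∈? F
    ... | yes xF = ∪-inʳ (∈⊤ & xF)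
    ... | no x∉F = ∪-inˡ (x∈p∧x∉q⇒x∈p─q ∈⊤ x∉F)

  module _ {F B : Subset n} (B-base : IsBase (M⟨ M ⟩ F) B) where

    private
      J : Subset n
      J = proj₁ (proj₂ (proj₁ (proj₂ (proj₁ B-base))))
      J-base : IsBase (sys M ∣ʳ F) J
      J-base = proj₁ (proj₂ (proj₂ (proj₁ (proj₂ (proj₁ B-base)))))
      iB/F : Ind M ((B ∩ (⊤ ─ F)) ∪ J)
      iB/F = proj₂ (proj₂ (proj₂ (proj₁ (proj₂ (proj₁ B-base)))))
      iB∣F : Ind M (B ∩ (⊤ ∩ F))
      iB∣F = proj₂ (proj₂ (proj₂ (proj₁ B-base)))

    -- Maximality in the summand M|F: B spans F.
    base-spans : Spans M B F
    base-spans {x} xF x∉B iBFx = x∉B (base-no-extension {N = M⟨ M ⟩ F} B-base (M⟨⟩-indep {F} J-base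
      (ind-down M iB/F (∪-lub (λ h → ∪-inˡ (∪⁅⁆-∩-outside (λ x∈E∖F → proj₂ (∈-─⁻ ⊤ F x∈E∖F) xF) h)) ∪-inʳ))
      (ind-down M iBFx (⊆-trans ∪⁅⁆-∩ (∪⁅⁆-mono (∩-monoʳ (p∩q⊆q ⊤ F)))))))

    private
      iBF : Ind M (B ∩ F)
      iBF = ind-down M iB∣F (∩-monoʳ ⊆⊤∩)

    -- B is independent in M: swap J for B ∩ F in (B ∖ F) ∪ J.
    base-indep : Ind M B
    base-indep = ind-down M (swap-restriction-base M (p∩q⊆q B (⊤ ─ F)) J-base iB/F iBF base-spans) split
      where
      split : B ⊆ (B ∩ (⊤ ─ F)) ∪ (B ∩ F)
      split {z} zB with z ∈? F
      ... | yes zF = ∪-inʳ (zB & zF)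
      ... | no z∉F = ∪-inˡ (zB & x∈p∧x∉q⇒x∈p─q ∈⊤ z∉F)

    base-spans-E : Spans M B ⊤
    base-spans-E {y} _ y∉B iBy = base-dependent (ind-down M iBy (∪⁅⁆-mono (λ h → h & ∈⊤)))
      where
      base-dependent : ¬ Ind M (B ∪ ⁅ y ⁆)
      base-dependent iB+y with y ∈? F
      ... | yes yF = base-spans yF y∉B (ind-down M iB+y (∪⁅⁆-mono (p∩q⊆p B F)))
      ... | no y∉F = y∉B (base-no-extension {N = M⟨ M ⟩ F} B-base (M⟨⟩-indep {F}
            (restriction-base M iBF base-spans)
            (ind-down M iB+y (∪-lub (p∩q⊆p _ _) (λ h → ∪-inˡ (p∩q⊆p B _ h))))
            (ind-down M base-indep (⊆-trans (∪⁅⁆-∩-outside (λ y∈E∩F → y∉F (p∩q⊆q ⊤ F y∈E∩F))) (p∩q⊆p B _)))))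

module _ {n} (Q : Subset n → Set) where

  F⁺-closed : Q ⊥ → (∀ {X Y} → Q X → Q Y → Q (X ∪ Y)) →
              ∀ {m} (F : Fin m → Subset n) → (∀ i → Q (F i)) → ∀ σ → Q (F⁺ F σ)
  F⁺-closed q⊥ q∪ F qF []          = q⊥
  F⁺-closed q⊥ q∪ F qF (true ∷ σ)  = q∪ (qF fzero) (F⁺-closed q⊥ q∪ (λ i → F (fsuc i)) (λ i → qF (fsuc i)) σ)
  F⁺-closed q⊥ q∪ F qF (false ∷ σ) = q∪ q⊥ (F⁺-closed q⊥ q∪ (λ i → F (fsuc i)) (λ i → qF (fsuc i)) σ)

  F⁻-closed : Q ⊤ → (∀ {X Y} → Q X → Q Y → Q (X ∩ Y)) →
              ∀ {m} (F : Fin m → Subset n) → (∀ i → Q (F i)) → ∀ σ → Q (F⁻ F σ)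
  F⁻-closed q⊤ q∩ F qF []          = q⊤
  F⁻-closed q⊤ q∩ F qF (true ∷ σ)  = q∩ q⊤ (F⁻-closed q⊤ q∩ (λ i → F (fsuc i)) (λ i → qF (fsuc i)) σ)
  F⁻-closed q⊤ q∩ F qF (false ∷ σ) = q∩ (qF fzero) (F⁻-closed q⊤ q∩ (λ i → F (fsuc i)) (λ i → qF (fsuc i)) σ)

profile : ∀ {n m} → (Fin m → Subset n) → Fin n → Subset m
profile {m = zero}  F x = []
profile {m = suc m} F x with x ∈? F fzero
... | yes _ = false ∷ profile (λ i → F (fsuc i)) x
... | no _  = true ∷ profile (λ i → F (fsuc i)) x

profile-∉F⁺ : ∀ {n m} (F : Fin m → Subset n) x → x ∉ F⁺ F (profile F x)
profile-∉F⁺ {m = zero}  F x x∈⊥ = ∉⊥ x∈⊥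
profile-∉F⁺ {m = suc m} F x with x ∈? F fzero
... | yes _   = λ h → [ ∉⊥ , profile-∉F⁺ (λ i → F (fsuc i)) x ] (x∈p∪q⁻ ⊥ _ h)
... | no x∉F₀ = λ h → [ x∉F₀ , profile-∉F⁺ (λ i → F (fsuc i)) x ] (x∈p∪q⁻ (F fzero) _ h)

profile-∈F⁻ : ∀ {n m} (F : Fin m → Subset n) x → x ∈ F⁻ F (profile F x)
profile-∈F⁻ {m = zero}  F x = ∈⊤
profile-∈F⁻ {m = suc m} F x with x ∈? F fzero
... | yes x∈F₀ = x∈F₀ & profile-∈F⁻ (λ i → F (fsuc i)) x
... | no _     = ∈⊤ & profile-∈F⁻ (λ i → F (fsuc i)) x

∈-⋃ : ∀ {n} {x : Fin n} {p} {ps : List (Subset n)} → x ∈ p → p ∈ˡ ps → x ∈ ⋃ ps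
∈-⋃ xp (hereˡ refl) = ∪-inˡ xp
∈-⋃ xp (thereˡ p∈ps) = ∪-inʳ (∈-⋃ xp p∈ps)

allSubsets-complete : ∀ {m} (σ : Subset m) → σ ∈ˡ allSubsets m
allSubsets-complete []          = hereˡ refl
allSubsets-complete (true ∷ σ)  = ∈-++⁺ˡ (∈-map⁺ (true ∷_) (allSubsets-complete σ))
allSubsets-complete (false ∷ σ) =
  ∈-++⁺ʳ (map (true ∷_) (allSubsets _)) (∈-map⁺ (false ∷_) (allSubsets-complete σ))

Piece : ∀ {n} → Matroid n → Subset n → Subset n → SetSystem n
Piece M P Q = (sys M /ᶜ P) ∣ʳ (Q ─ P)

profile-∈-Piece : ∀ {n m} (M : Matroid n) (F : Fin m → Subset n) x →
                  x ∈ ground (Piece M (F⁺ F (profile F x)) (F⁻ F (profile F x)))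
profile-∈-Piece M F x =
  x∈p∧x∉q⇒x∈p─q ∈⊤ (profile-∉F⁺ F x) & x∈p∧x∉q⇒x∈p─q (profile-∈F⁻ F x) (profile-∉F⁺ F x)

⨀-covers : ∀ {n m} (M : Matroid n) (F : Fin m → Subset n) x → x ∈ ground (⨀ M F)
⨀-covers M F x = ∈-⋃ (profile-∈-Piece M F x) (∈-map⁺ _ (allSubsets-complete (profile F x)))

module _ {n} (M : Matroid n) {B P Q : Subset n} (iB : Ind M B) (B-spans-P : Spans M B P) where

  -- B meets the summand in an independent set: B ∩ P is a basis of M|P.
  piece-indep : Indep (Piece M P Q) (B ∩ ground (Piece M P Q))
  piece-indep =
    p∩q⊆q B _ , (λ h → p∩q⊆p _ _ (p∩q⊆q B _ h)) ,
    B ∩ (⊤ ∩ P) , restriction-base M (ind-down M iB (p∩q⊆p B P)) B-spans-P ,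
    ind-down M iB (∪-lub (p∩q⊆p B _) (p∩q⊆p B _))

  -- If B also spans Q, then B ∩ (Q ∖ P) is maximal in the summand: a larger
  -- independent X would let (B ∩ (Q ∖ P)) ∪ (B ∩ P) be augmented by an
  -- element of P or Q outside B, contradicting that B spans P and Q.
  piece-maximal : Spans M B Q → ∀ {X} → Indep (Piece M P Q) X →
                  B ∩ ground (Piece M P Q) ⊆ X → X ⊆ B
  piece-maximal B-spans-Q {X} (X⊆G , X⊆E∖P , J , J-base@((J⊆P , _) , _) , iXJ) BG⊆X {x} xX =
    decidable-stable (x ∈? B) λ x∉B →
      escape (ind-aug M iA iXJ (card x∉B))
    where
    G : Subset n
    G = ground (Piece M P Q)
    A : Subset n
    A = (B ∩ G) ∪ (B ∩ (⊤ ∩ P))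
    iA : Ind M A
    iA = ind-down M iB (∪-lub (p∩q⊆p B _) (p∩q⊆p B _))
    card : x ∉ B → ∣ A ∣ < ∣ X ∪ J ∣
    card x∉B = begin-strict
      ∣ A ∣                         ≤⟨ ∣p∪q∣≤∣p∣+∣q∣ (B ∩ G) _ ⟩
      ∣ B ∩ G ∣ + ∣ B ∩ (⊤ ∩ P) ∣   ≤⟨ +-monoʳ-≤ ∣ B ∩ G ∣
                                         (restriction-base-card M BP⊆P (ind-down M iB (p∩q⊆p B _)) J-base) ⟩
      ∣ B ∩ G ∣ + ∣ J ∣             <⟨ +-monoˡ-< ∣ J ∣ (⊂⇒∣<∣ BG⊆X xX (λ h → x∉B (p∩q⊆p B G h))) ⟩
      ∣ X ∣ + ∣ J ∣                 ≤⟨ disjoint⇒∣p∣+∣q∣≤∣p∪q∣ X J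
                                         (λ zX zJ → proj₂ (∈-─⁻ ⊤ P (X⊆E∖P zX)) (p∩q⊆q ⊤ P (J⊆P zJ))) ⟩
      ∣ X ∪ J ∣                     ∎
      where
      open ≤-Reasoning
      BP⊆P : B ∩ (⊤ ∩ P) ⊆ P
      BP⊆P h = p∩q⊆q ⊤ P (p∩q⊆q B _ h)
    BQ⊆A : B ∩ Q ⊆ A
    BQ⊆A {z} h with ∈-∩⁻ h | z ∈? P
    ... | zB , _  | yes zP = ∪-inʳ (zB & ∈⊤ & zP)
    ... | zB , zQ | no z∉P = ∪-inˡ (zB & x∈p∧x∉q⇒x∈p─q ∈⊤ z∉P & x∈p∧x∉q⇒x∈p─q zQ z∉P)
    escape : ¬ ∃ λ y → y ∈ X ∪ J × y ∉ A × Ind M (A ∪ ⁅ y ⁆)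
    escape (y , yXJ , y∉A , iAy) with x∈p∪q⁻ X J yXJ
    ... | inj₁ yX = B-spans-Q yQ (λ yB → y∉A (∪-inˡ (yB & X⊆G yX))) (ind-down M iAy (∪⁅⁆-mono BQ⊆A))
      where
      yQ : y ∈ Q
      yQ = proj₁ (∈-─⁻ Q P (p∩q⊆q _ _ (X⊆G yX)))
    ... | inj₂ yJ = B-spans-P (p∩q⊆q ⊤ P (J⊆P yJ)) (λ yB → y∉A (∪-inʳ (yB & J⊆P yJ)))
                      (ind-down M iAy (∪⁅⁆-mono (λ h → ∪-inʳ (∩-monoʳ ⊆⊤∩ h))))

proposition2p21 : ∀ {n m} (M : Matroid n) (F : Fin (suc m) → Subset n) (B : Subset n) →
    (∀ i → IsBase (M⟨ M ⟩ (F i)) B) → IsBase (⨀ M F) B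
proposition2p21 {m = m} M F B B-base = B-indep , B-maximal
  where
  -- index 0 exists, and any single F_i already shows B is a base of M
  iB : Ind M B
  iB = base-indep M (B-base fzero)
  B-spans-E : Spans M B ⊤
  B-spans-E = base-spans-E M (B-base fzero)
  B-spans-Fᵢ : ∀ i → Spans M B (F i)
  B-spans-Fᵢ i = base-spans M (B-base i)
  B-spans-F⁺ : ∀ σ → Spans M B (F⁺ F σ)
  B-spans-F⁺ = F⁺-closed (Spans M B) (spans-⊥ M) (spans-∪ M) F B-spans-Fᵢ
  B-spans-F⁻ : ∀ σ → Spans M B (F⁻ F σ)
  B-spans-F⁻ = F⁻-closed (Spans M B) B-spans-E (spans-∩ M iB B-spans-E) F B-spans-Fᵢ
  B-indep : Indep (⨀ M F) B
  B-indep = (λ {x} _ → ⨀-covers M F x) , λ σ → piece-indep M iB (B-spans-F⁺ σ)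
  B-maximal : ∀ I → Indep (⨀ M F) I → B ⊆ I → I ⊆ B
  B-maximal I (_ , I-indep) B⊆I {x} xI =
    piece-maximal M iB (B-spans-F⁺ σ) (B-spans-F⁻ σ) (I-indep σ) (∩-monoˡ B⊆I) (xI & profile-∈-Piece M F x)
    where
    σ : Subset (suc m)
    σ = profile F x
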